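{- Let $R_1,\dots,R_m$ be the rows of a gapless multiple sequence alignment of $m$ strings of length $n$, and let $S$ be a segmentation with column intervals $[j^{(i)}..k^{(i)}]$, $1\le i\le b$, inducing the founder block graph $G(S)=(V,E,\ell)$ with blocks $V^1,\dots,V^b$. Then $S$ is valid if and only if for every $i\in[1..b]$, every $v\in V^i$, every row $t\in[1..m]$ and every column $j\neq j^{(i)}$ (with $j+|\ell(v)|-1\le n$), we have $R_t[j..j+|\ell(v)|-1]\neq\ell(v)$.
   Context: A segmentation of the MSA is given by column boundaries $1=j^{(1)}\le k^{(1)}<j^{(2)}\le\cdots\le k^{(b)}=n$ with $j^{(i+1)}=k^{(i)}+1$ (so $j^{(i)}=1+\sum_{h<i}(k^{(h)}-j^{(h)}+1)$), and sets $S^i=\{R_t[j^{(i)}..k^{(i)}]:1\le t\le m\}$. The induced founder block graph $G(S)$ has, for each $i$, a block $V^i$ whose nodes are labelled bijectively by the distinct strings in $S^i$, and an edge $(v,w)$ with $v\in V^i,w\in V^{i+1}$ iff $R_t[j^{(i)}..k^{(i+1)}]=\ell(v)\ell(w)$ for some row $t$. Edges are directed left to right; the label of a path is the concatenation of its node labels; a string occurs in $G(S)$ if it is a substring of the label of some path. $G(S)$ is segment repeat-free if for every node $v$, every occurrence of $\ell(v)$ as a substring of the label of a path $u_1\cdots u_k$ coincides exactly with the part spelled by a node $u_i=v$. The segmentation $S$ is valid if $G(S)$ is segment repeat-free. -}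

module Defs where

open import Data.Nat using (ℕ; zero; suc; _+_; _≤_; _<_)
open import Data.Fin using (Fin; toℕ)
open import Data.List using (List; []; _∷_; [_]; length; take; drop; map; concat; _++_; lookup)
open import Data.Nat.ListAction using (sum)
open import Data.List.Relation.Unary.All using (All)
open import Data.Vec using (Vec; toList)
open import Data.Product using (Σ; ∃; _×_)
open import Relation.Binary.PropositionalEquality using (_≡_; _≢_)
open import Relation.Nullary using (¬_)

-- Conventions: columns are 0-based internally (column j here = column j+1 in the paper),
-- blocks are indexed 0..b-1.  A substring is given by a start column and a length.

sub : {A : Set} → List A → ℕ → ℕ → List A
sub xs j len = take len (drop j xs)

MSA : Set → ℕ → ℕ → Set
MSA A m n = Fin m → Vec A n

-- A segmentation of the columns [1..n] into consecutive nonempty intervals,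
-- given by the list of interval lengths k^(i) - j^(i) + 1 (each ≥ 1, summing to n).
record Segmentation (n : ℕ) : Set where
  field
    lens     : List ℕ
    nonempty : All (λ l → 1 ≤ l) lens
    total    : sum lens ≡ n
open Segmentation public

blocks : {n : ℕ} → Segmentation n → ℕ
blocks S = length (lens S)

-- length of block i (0 if out of range; only used for i < b)
nthLen : List ℕ → ℕ → ℕ
nthLen []       _       = 0
nthLen (l ∷ ls) zero    = l
nthLen (l ∷ ls) (suc i) = nthLen ls i

blockLen : {n : ℕ} → Segmentation n → ℕ → ℕ
blockLen S i = nthLen (lens S) i

blockStart : {n : ℕ} → Segmentation n → ℕ → ℕ
blockStart S i = sum (take i (lens S))

module _ {A : Set} {m n : ℕ} (R : MSA A m n) (S : Segmentation n) where

  row : Fin m → List A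
  row t = toList (R t)

  -- s ∈ S^i : nodes of block V^i are identified with (i , s) for the distinct strings s ∈ S^i
  IsNode : ℕ → List A → Set
  IsNode i s = i < blocks S × ∃ λ (t : Fin m) → sub (row t) (blockStart S i) (blockLen S i) ≡ s

  Edge : ℕ → List A → List A → Set
  Edge i s s' = suc i < blocks S ×
    ∃ λ (t : Fin m) → sub (row t) (blockStart S i) (blockLen S i + blockLen S (suc i)) ≡ s ++ s'

  -- Path p ss : a (nonempty) path in G(S) whose first node lies in block p and whose
  -- consecutive nodes have labels ss (the r-th node lies in block p + r).
  data Path : ℕ → List (List A) → Set where
    single : ∀ {i s} → IsNode i s → Path i [ s ]
    step   : ∀ {i s s' ss} → Edge i s s' → Path (suc i) (s' ∷ ss) → Path i (s ∷ s' ∷ ss)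

  -- G(S) is segment repeat-free: every occurrence of the label of node v = (i , s)
  -- in the label of a path coincides exactly with a node u_r = v of that path.
  SegmentRepeatFree : Set
  SegmentRepeatFree =
    ∀ (i : ℕ) (s : List A) → IsNode i s →
    ∀ (p : ℕ) (ss : List (List A)) → Path p ss →
    ∀ (o : ℕ) → o + length s ≤ length (concat ss) → sub (concat ss) o (length s) ≡ s →
    ∃ λ (r : Fin (length ss)) →
      p + toℕ r ≡ i × lookup ss r ≡ s × o ≡ sum (map length (take (toℕ r) ss))

  Valid : Set
  Valid = SegmentRepeatFree

  NoOtherRowOccurrence : Set
  NoOtherRowOccurrence =
    ∀ (i : ℕ) (s : List A) → IsNode i s →
    ∀ (t : Fin m) (j : ℕ) → j ≢ blockStart S i → j + length s ≤ n →
    sub (row t) j (length s) ≢ s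

module Submission where

-- (⇒) Row t spells the path through its own blocks, so an occurrence of ℓ(v) at a
-- column j ≠ j⁽ⁱ⁾ of row t is an occurrence in a path label that no node accounts for.
-- (⇐) Take an occurrence of ℓ(v), v ∈ Vⁱ, starting inside the first node u ∈ Vᵖ of a
-- path u u′ ⋯.  Either it ends within u u′, which is the label of an edge and hence a
-- window of some row, so the hypothesis puts its column at j⁽ⁱ⁾; or it covers u′
-- completely, so ℓ(u′) occurs in ℓ(v) and hence in a row, which puts that occurrence
-- of ℓ(u′) at j⁽ᵖ⁺¹⁾ and again the occurrence of ℓ(v) at j⁽ⁱ⁾.  Since the blocks
-- partition the columns, a start at j⁽ⁱ⁾ inside block p forces i = p and offset 0.

open import Defs
open import Data.Nat using (ℕ; zero; suc; _+_; _≤_; _<_; z≤n; s≤s; _≟_; _≤?_)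
open import Data.Nat.Properties
open import Data.Nat.ListAction using (sum)
open import Data.Fin as Fin using (Fin; toℕ)
open import Data.List using (List; []; _∷_; length; take; drop; map; concat; _++_; lookup)
open import Data.List.Properties
  using (length-++; ++-assoc; ++-identityʳ; take-[]; take-take; take-drop; take-map; take-all; drop-drop; length-drop)
open import Data.List.Relation.Unary.All using (All; _∷_)
open import Data.Vec.Properties using (length-toList)
open import Data.Product using (∃; _×_; _,_; proj₁)
open import Data.Empty using (⊥-elim)
open import Relation.Nullary using (yes; no)
open import Relation.Nullary.Decidable using (decidable-stable)
open import Relation.Binary using (tri<; tri≈; tri>)
open import Relation.Binary.PropositionalEquality

module _ {A : Set} where

  take-++-length : ∀ (u w : List A) → take (length u) (u ++ w) ≡ u
  take-++-length []      w = refl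
  take-++-length (x ∷ u) w = cong (x ∷_) (take-++-length u w)

  take-++ˡ : ∀ k (u w : List A) → k ≤ length u → take k (u ++ w) ≡ take k u
  take-++ˡ zero    u       w k≤u       = refl
  take-++ˡ (suc k) (x ∷ u) w (s≤s k≤u) = cong (x ∷_) (take-++ˡ k u w k≤u)

  take-+ : ∀ L M (xs : List A) → take (L + M) xs ≡ take L xs ++ take M (drop L xs)
  take-+ zero    M xs       = refl
  take-+ (suc L) M []       = sym (take-[] M)
  take-+ (suc L) M (x ∷ xs) = cong (x ∷_) (take-+ L M xs)

  take-take≤ : ∀ {k L} (xs : List A) → k ≤ L → take k (take L xs) ≡ take k xs
  take-take≤ {k} {L} xs k≤L = trans (take-take k L xs) (cong (λ j → take j xs) (m≤n⇒m⊓n≡m k≤L))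

  length-sub : ∀ (xs : List A) c L → c + L ≤ length xs → length (sub xs c L) ≡ L
  length-sub xs       zero    zero    _         = refl
  length-sub (x ∷ xs) zero    (suc L) (s≤s le)  = cong suc (length-sub xs zero L le)
  length-sub (x ∷ xs) (suc c) L       (s≤s le)  = length-sub xs c L le

  sub-sub : ∀ (xs : List A) c L o k → o + k ≤ L → sub (sub xs c L) o k ≡ sub xs (c + o) k
  sub-sub xs c L o k o+k≤L = begin
    take k (drop o (take L ys))        ≡⟨ take-drop k o (take L ys) ⟩
    drop o (take (o + k) (take L ys))  ≡⟨ cong (drop o) (take-take≤ ys o+k≤L) ⟩
    drop o (take (o + k) ys)           ≡⟨ take-drop k o ys ⟨
    take k (drop o ys)                 ≡⟨ cong (take k) (drop-drop c o xs) ⟩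
    take k (drop (c + o) xs)           ∎
    where
    open ≡-Reasoning
    ys = drop c xs

  sub-++ˡ : ∀ (u w : List A) o k → o + k ≤ length u → sub (u ++ w) o k ≡ sub u o k
  sub-++ˡ u       w zero    k le       = take-++ˡ k u w le
  sub-++ˡ (x ∷ u) w (suc o) k (s≤s le) = sub-++ˡ u w o k le

  sub-++ʳ : ∀ (u w : List A) o k → sub (u ++ w) (length u + o) k ≡ sub w o k
  sub-++ʳ []      w o k = refl
  sub-++ʳ (x ∷ u) w o k = sub-++ʳ u w o k

  sub-covers-middle : ∀ (u v w : List A) o d k → o + d ≡ length u → d + length v ≤ k →
                      sub (sub (u ++ v ++ w) o k) d (length v) ≡ v
  sub-covers-middle u v w o d k o+d≡u d+v≤k = begin
    sub (sub (u ++ v ++ w) o k) d (length v)  ≡⟨ sub-sub (u ++ v ++ w) o k d (length v) d+v≤k ⟩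
    sub (u ++ v ++ w) (o + d) (length v)      ≡⟨ cong (λ c → sub (u ++ v ++ w) c (length v)) o+d≡u+0 ⟩
    sub (u ++ v ++ w) (length u + 0) (length v) ≡⟨ sub-++ʳ u (v ++ w) 0 (length v) ⟩
    take (length v) (v ++ w)                  ≡⟨ take-++-length v w ⟩
    v                                         ∎
    where
    open ≡-Reasoning
    o+d≡u+0 = trans o+d≡u (sym (+-identityʳ (length u)))

  segments : List A → List ℕ → List (List A)
  segments xs []       = []
  segments xs (l ∷ ls) = take l xs ∷ segments (drop l xs) ls

  concat-segments : ∀ (xs : List A) ls → concat (segments xs ls) ≡ take (sum ls) xs
  concat-segments xs []       = refl
  concat-segments xs (l ∷ ls) =
    trans (cong (take l xs ++_) (concat-segments (drop l xs) ls)) (sym (take-+ l (sum ls) xs))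

  map-length-segments : ∀ (xs : List A) ls → sum ls ≤ length xs → map length (segments xs ls) ≡ ls
  map-length-segments xs []       _  = refl
  map-length-segments xs (l ∷ ls) le =
    cong₂ _∷_ (length-sub xs 0 l (m+n≤o⇒m≤o l le)) (map-length-segments (drop l xs) ls ls≤)
    where
    ls≤ : sum ls ≤ length (drop l xs)
    ls≤ = subst (sum ls ≤_) (sym (length-drop l xs))
                (m+n≤o⇒m≤o∸n (sum ls) (subst (_≤ length xs) (+-comm l (sum ls)) le))

  sum-lengths-take-segments : ∀ (xs : List A) ls r → sum ls ≤ length xs →
                              sum (map length (take r (segments xs ls))) ≡ sum (take r ls)
  sum-lengths-take-segments xs ls r le =
    trans (cong sum (sym (take-map r (segments xs ls))))
          (cong (λ ks → sum (take r ks)) (map-length-segments xs ls le))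

nthLen-All : ∀ {P : ℕ → Set} {ls} i → All P ls → i < length ls → P (nthLen ls i)
nthLen-All zero    (p ∷ ps) _         = p
nthLen-All (suc i) (p ∷ ps) (s≤s i<l) = nthLen-All i ps i<l

drop≡∷ : ∀ (ls : List ℕ) k {l ls′} → drop k ls ≡ l ∷ ls′ →
         k < length ls × nthLen ls k ≡ l × drop (suc k) ls ≡ ls′
drop≡∷ (x ∷ ls) zero    refl = s≤s z≤n , refl , refl
drop≡∷ (x ∷ ls) (suc k) eq   with drop≡∷ ls k eq
... | k<l , nth≡ , drop≡ = s≤s k<l , nth≡ , drop≡

sum-take-suc : ∀ (ls : List ℕ) i → sum (take (suc i) ls) ≡ sum (take i ls) + nthLen ls i
sum-take-suc []       zero    = refl
sum-take-suc []       (suc i) = refl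
sum-take-suc (l ∷ ls) zero    = +-identityʳ l
sum-take-suc (l ∷ ls) (suc i) = trans (cong (l +_) (sum-take-suc ls i)) (sym (+-assoc l _ _))

sum-take-mono : ∀ (ls : List ℕ) {i j} → i ≤ j → sum (take i ls) ≤ sum (take j ls)
sum-take-mono ls       z≤n       = z≤n
sum-take-mono []       (s≤s i≤j) = z≤n
sum-take-mono (l ∷ ls) (s≤s i≤j) = +-monoʳ-≤ l (sum-take-mono ls i≤j)

sum-take≤sum : ∀ (ls : List ℕ) i → sum (take i ls) ≤ sum ls
sum-take≤sum ls       zero    = z≤n
sum-take≤sum []       (suc i) = z≤n
sum-take≤sum (l ∷ ls) (suc i) = +-monoʳ-≤ l (sum-take≤sum ls i)

module _ {n : ℕ} (S : Segmentation n) where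

  blockStart-suc : ∀ i → blockStart S (suc i) ≡ blockStart S i + blockLen S i
  blockStart-suc = sum-take-suc (lens S)

  blockStart-mono : ∀ {i j} → i ≤ j → blockStart S i ≤ blockStart S j
  blockStart-mono = sum-take-mono (lens S)

  blockLen-pos : ∀ {i} → i < blocks S → 0 < blockLen S i
  blockLen-pos {i} = nthLen-All i (nonempty S)

  blockStart-strict : ∀ {i} → i < blocks S → blockStart S i < blockStart S (suc i)
  blockStart-strict {i} i<b =
    subst (blockStart S i <_) (sym (blockStart-suc i)) (m<m+n (blockStart S i) (blockLen-pos i<b))

  blockEnd≤n : ∀ i → blockStart S i + blockLen S i ≤ n
  blockEnd≤n i = subst₂ _≤_ (blockStart-suc i) (total S) (sum-take≤sum (lens S) (suc i))

  twoBlocksEnd≤n : ∀ i → blockStart S i + (blockLen S i + blockLen S (suc i)) ≤ n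
  twoBlocksEnd≤n i = subst (_≤ n)
    (trans (cong (_+ blockLen S (suc i)) (blockStart-suc i)) (+-assoc (blockStart S i) _ _))
    (blockEnd≤n (suc i))

  blockStart-aligned : ∀ {i p o} → i < blocks S → blockStart S i ≡ blockStart S p + o →
                       o < blockLen S p → i ≡ p × o ≡ 0
  blockStart-aligned {i} {p} {o} i<b eq o<len with <-cmp i p
  ... | tri< i<p _ _ = ⊥-elim (<-irrefl refl (begin-strict
        blockStart S i        <⟨ blockStart-strict i<b ⟩
        blockStart S (suc i)  ≤⟨ blockStart-mono i<p ⟩
        blockStart S p        ≤⟨ m≤m+n (blockStart S p) o ⟩
        blockStart S p + o    ≡⟨ eq ⟨
        blockStart S i        ∎))
    where open ≤-Reasoning
  ... | tri> _ _ p<i = ⊥-elim (<-irrefl refl (begin-strict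
        blockStart S p + o               <⟨ +-monoʳ-< (blockStart S p) o<len ⟩
        blockStart S p + blockLen S p    ≡⟨ blockStart-suc p ⟨
        blockStart S (suc p)             ≤⟨ blockStart-mono p<i ⟩
        blockStart S i                   ≡⟨ eq ⟩
        blockStart S p + o               ∎))
    where open ≤-Reasoning
  ... | tri≈ _ refl _ = refl , +-cancelˡ-≡ (blockStart S p) o 0 (trans (sym eq) (sym (+-identityʳ _)))

module _ {A : Set} {m n : ℕ} (R : MSA A m n) (S : Segmentation n) where

  SpelledByNode : ℕ → List (List A) → ℕ → List A → ℕ → Set
  SpelledByNode p ss i s o = ∃ λ (r : Fin (length ss)) →
    p + toℕ r ≡ i × lookup ss r ≡ s × o ≡ sum (map length (take (toℕ r) ss))

  SpelledByNode-∷ : ∀ {p ss i s o} u → SpelledByNode (suc p) ss i s o →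
                    SpelledByNode p (u ∷ ss) i s (length u + o)
  SpelledByNode-∷ {p} u (r , p+r≡i , lookup≡ , o≡) =
    Fin.suc r , trans (+-suc p (toℕ r)) p+r≡i , lookup≡ , cong (length u +_) o≡

  length-row : ∀ t → length (row R S t) ≡ n
  length-row t = length-toList (R t)

  length-window : ∀ t c L → c + L ≤ n → length (sub (row R S t) c L) ≡ L
  length-window t c L c+L≤n = length-sub (row R S t) c L (subst (c + L ≤_) (sym (length-row t)) c+L≤n)

  IsNode⇒length : ∀ {i s} → IsNode R S i s → length s ≡ blockLen S i
  IsNode⇒length {i} (_ , t , block≡s) =
    trans (cong length (sym block≡s)) (length-window t (blockStart S i) (blockLen S i) (blockEnd≤n S i))

  Path⇒IsNode-head : ∀ {p u ss} → Path R S p (u ∷ ss) → IsNode R S p u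
  Path⇒IsNode-head (single node) = node
  Path⇒IsNode-head {p} {u} (step {s' = u′} (sp<b , t , edge) P) = <-trans (n<1+n p) sp<b , t , block≡u
    where
    open ≡-Reasoning
    L  = blockLen S p
    L′ = blockLen S (suc p)
    ys = drop (blockStart S p) (row R S t)
    |u|≡L : length u ≡ L
    |u|≡L = +-cancelʳ-≡ L′ (length u) L (begin
      length u + L′           ≡⟨ cong (length u +_) (IsNode⇒length (Path⇒IsNode-head P)) ⟨
      length u + length u′    ≡⟨ length-++ u ⟨
      length (u ++ u′)        ≡⟨ cong length edge ⟨
      length (take (L + L′) ys) ≡⟨ length-window t (blockStart S p) (L + L′) (twoBlocksEnd≤n S p) ⟩
      L + L′                  ∎)
    block≡u : take L ys ≡ u
    block≡u = begin
      take L ys                 ≡⟨ take-take≤ ys (m≤m+n L L′) ⟨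
      take L (take (L + L′) ys) ≡⟨ cong (take L) edge ⟩
      take L (u ++ u′)          ≡⟨ cong (λ k → take k (u ++ u′)) |u|≡L ⟨
      take (length u) (u ++ u′) ≡⟨ take-++-length u u′ ⟩
      u                         ∎

  rowPath : ∀ t k {l ls} → drop k (lens S) ≡ l ∷ ls →
            Path R S k (segments (drop (blockStart S k) (row R S t)) (l ∷ ls))
  rowPath t k eq with drop≡∷ (lens S) k eq
  rowPath t k {ls = []}      _  | k<b , refl , _   = single (k<b , t , refl)
  rowPath t k {ls = l′ ∷ ls} _  | _   , refl , eq′ with drop≡∷ (lens S) (suc k) eq′
  ... | sk<b , refl , _ = step (sk<b , t , take-+ (blockLen S k) (blockLen S (suc k)) ys)
                               (subst (λ zs → Path R S (suc k) (segments zs (blockLen S (suc k) ∷ ls)))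
                                      drop-next (rowPath t (suc k) eq′))
    where
    ys = drop (blockStart S k) (row R S t)
    drop-next : drop (blockStart S (suc k)) (row R S t) ≡ drop (blockLen S k) ys
    drop-next = trans (cong (λ c → drop c (row R S t)) (blockStart-suc S k))
                      (sym (drop-drop (blockStart S k) (blockLen S k) (row R S t)))

  fullRowPath : ∀ t → 0 < blocks S → Path R S 0 (segments (row R S t) (lens S))
  fullRowPath t 0<b with lens S in eq
  fullRowPath t ()  | []
  ... | _ ∷ _ = rowPath t 0 eq

  SpelledByNode-row⇒blockStart : ∀ t {i s j} → SpelledByNode 0 (segments (row R S t) (lens S)) i s j →
                                  j ≡ blockStart S i
  SpelledByNode-row⇒blockStart t (r , refl , _ , j≡) =
    trans j≡ (sum-lengths-take-segments (row R S t) (lens S) (toℕ r) lens≤row)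
    where
    lens≤row = ≤-reflexive (trans (total S) (sym (length-row t)))

  valid⇒noOtherRowOccurrence : Valid R S → NoOtherRowOccurrence R S
  valid⇒noOtherRowOccurrence valid i s node@(i<b , _) t j j≢ j+s≤n occ =
    j≢ (SpelledByNode-row⇒blockStart t
         (valid i s node 0 segs (fullRowPath t (≤-<-trans z≤n i<b)) j
                (subst (j + length s ≤_) (sym (trans (cong length segs≡row) (length-row t))) j+s≤n)
                (trans (cong (λ xs → sub xs j (length s)) segs≡row) occ)))
    where
    segs = segments (row R S t) (lens S)
    segs≡row : concat segs ≡ row R S t
    segs≡row = trans (concat-segments (row R S t) (lens S))
      (take-all (sum (lens S)) (row R S t) (≤-reflexive (trans (length-row t) (sym (total S)))))

  module _ (noOther : NoOtherRowOccurrence R S) where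

    occurrence⇒blockStart : ∀ {i s} → IsNode R S i s → ∀ t c → c + length s ≤ n →
                            sub (row R S t) c (length s) ≡ s → c ≡ blockStart S i
    occurrence⇒blockStart {i} {s} node t c bound occ =
      decidable-stable (c ≟ blockStart S i) (λ c≢ → noOther i s node t c c≢ bound occ)

    windowOccurrence⇒blockStart : ∀ {i s} → IsNode R S i s → ∀ t c L w o →
                                  c + L ≤ n → o + length s ≤ L →
                                  sub (sub (row R S t) c L ++ w) o (length s) ≡ s → c + o ≡ blockStart S i
    windowOccurrence⇒blockStart {s = s} node t c L w o c+L≤n o+s≤L occ =
      occurrence⇒blockStart node t (c + o) bound (begin
        sub (row R S t) (c + o) (length s)  ≡⟨ sub-sub (row R S t) c L o (length s) o+s≤L ⟨
        sub X o (length s)                  ≡⟨ sub-++ˡ X w o (length s) o+s≤X ⟨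
        sub (X ++ w) o (length s)           ≡⟨ occ ⟩
        s                                   ∎)
      where
      open ≡-Reasoning
      X = sub (row R S t) c L
      o+s≤X = subst (o + length s ≤_) (sym (length-window t c L c+L≤n)) o+s≤L
      bound : c + o + length s ≤ n
      bound = subst (_≤ n) (sym (+-assoc c o (length s))) (≤-trans (+-monoʳ-≤ c o+s≤L) c+L≤n)

    coveringOccurrence⇒blockStart : ∀ {i s p u′} u w → IsNode R S i s → IsNode R S (suc p) u′ →
      length u ≡ blockLen S p → ∀ o d → o + d ≡ length u → d + length u′ ≤ length s →
      sub (u ++ u′ ++ w) o (length s) ≡ s → blockStart S p + o ≡ blockStart S i
    coveringOccurrence⇒blockStart {i} {s} {p} {u′} u w node@(_ , t , block≡s) node′ |u|≡L
                                  o d o+d≡u d+u′≤s occ =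
      +-cancelʳ-≡ d _ _ (begin
        blockStart S p + o + d         ≡⟨ +-assoc (blockStart S p) o d ⟩
        blockStart S p + (o + d)       ≡⟨ cong (blockStart S p +_) (trans o+d≡u |u|≡L) ⟩
        blockStart S p + blockLen S p  ≡⟨ blockStart-suc S p ⟨
        blockStart S (suc p)           ≡⟨ u′-at-blockStart ⟨
        blockStart S i + d             ∎)
      where
      open ≡-Reasoning
      u′-in-s : sub (sub (row R S t) (blockStart S i) (blockLen S i) ++ []) d (length u′) ≡ u′
      u′-in-s = begin
        sub (sub (row R S t) (blockStart S i) (blockLen S i) ++ []) d (length u′)
          ≡⟨ cong (λ xs → sub xs d (length u′)) (trans (++-identityʳ _) block≡s) ⟩
        sub s d (length u′)
          ≡⟨ cong (λ xs → sub xs d (length u′)) occ ⟨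
        sub (sub (u ++ u′ ++ w) o (length s)) d (length u′)
          ≡⟨ sub-covers-middle u u′ w o d (length s) o+d≡u d+u′≤s ⟩
        u′ ∎
      u′-at-blockStart : blockStart S i + d ≡ blockStart S (suc p)
      u′-at-blockStart = windowOccurrence⇒blockStart node′ t (blockStart S i) (blockLen S i) [] d
        (blockEnd≤n S i) (subst (d + length u′ ≤_) (IsNode⇒length node) d+u′≤s) u′-in-s

    firstNodeOccurrence⇒blockStart : ∀ {i s p u ss} → IsNode R S i s → Path R S p (u ∷ ss) →
      ∀ o → o < length u →
      o + length s ≤ length (concat (u ∷ ss)) → sub (concat (u ∷ ss)) o (length s) ≡ s →
      blockStart S p + o ≡ blockStart S i
    firstNodeOccurrence⇒blockStart {s = s} {p} node (single (_ , t , refl)) o _ bound occ =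
      windowOccurrence⇒blockStart node t (blockStart S p) (blockLen S p) [] o (blockEnd≤n S p) fits occ
      where
      u = sub (row R S t) (blockStart S p) (blockLen S p)
      fits : o + length s ≤ blockLen S p
      fits = subst (o + length s ≤_)
        (trans (cong length (++-identityʳ u)) (length-window t (blockStart S p) (blockLen S p) (blockEnd≤n S p)))
        bound
    firstNodeOccurrence⇒blockStart {s = s} {p} {u} node path@(step {s' = u′} {ss} (_ , t , edge) P)
                                   o o<u bound occ
      with o + length s ≤? length u + length u′
    ... | yes fits = windowOccurrence⇒blockStart node t (blockStart S p) (blockLen S p + blockLen S (suc p))
                       (concat ss) o (twoBlocksEnd≤n S p)
                       (subst (o + length s ≤_) (cong₂ _+_ |u|≡L |u′|≡L′) fits)
                       (trans (cong (λ xs → sub (xs ++ concat ss) o (length s)) edge)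
                              (trans (cong (λ xs → sub xs o (length s)) (++-assoc u u′ (concat ss))) occ))
      where
      |u|≡L  = IsNode⇒length (Path⇒IsNode-head path)
      |u′|≡L′ = IsNode⇒length (Path⇒IsNode-head P)
    ... | no spans with m≤n⇒∃[o]m+o≡n (<⇒≤ o<u)
    ...   | d , o+d≡u = coveringOccurrence⇒blockStart u (concat ss) node (Path⇒IsNode-head P)
                          (IsNode⇒length (Path⇒IsNode-head path)) o d o+d≡u d+u′≤s occ
      where
      d+u′≤s : d + length u′ ≤ length s
      d+u′≤s = +-cancelˡ-≤ o _ _ (subst (_≤ o + length s)
                 (trans (cong (_+ length u′) (sym o+d≡u)) (+-assoc o d (length u′))) (<⇒≤ (≰⇒> spans)))

    firstNodeOccurrence⇒SpelledByNode : ∀ {i s p u ss} → IsNode R S i s → Path R S p (u ∷ ss) →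
      ∀ o → o < length u →
      o + length s ≤ length (concat (u ∷ ss)) → sub (concat (u ∷ ss)) o (length s) ≡ s →
      SpelledByNode p (u ∷ ss) i s o
    firstNodeOccurrence⇒SpelledByNode {s = s} {p} {u} {ss} node@(i<b , _) P o o<u bound occ
      with blockStart-aligned S i<b (sym (firstNodeOccurrence⇒blockStart node P o o<u bound occ))
             (subst (o <_) (IsNode⇒length (Path⇒IsNode-head P)) o<u)
    ... | refl , refl = Fin.zero , +-identityʳ p , u≡s , refl
      where
      open ≡-Reasoning
      |u|≡|s| = trans (IsNode⇒length (Path⇒IsNode-head P)) (sym (IsNode⇒length node))
      u≡s : u ≡ s
      u≡s = begin
        u                                  ≡⟨ take-++-length u (concat ss) ⟨
        take (length u) (concat (u ∷ ss))  ≡⟨ cong (λ k → take k (concat (u ∷ ss))) |u|≡|s| ⟩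
        take (length s) (concat (u ∷ ss))  ≡⟨ occ ⟩
        s                                  ∎

    noOtherRowOccurrence⇒segmentRepeatFree : SegmentRepeatFree R S
    noOtherRowOccurrence⇒segmentRepeatFree i s node p (u ∷ []) P@(single _) o bound occ =
      firstNodeOccurrence⇒SpelledByNode node P o o<u bound occ
      where
      o<u : o < length u
      o<u = <-≤-trans (m<m+n o (subst (0 <_) (sym (IsNode⇒length node)) (blockLen-pos S (proj₁ node))))
                      (subst (o + length s ≤_) (cong length (++-identityʳ u)) bound)
    noOtherRowOccurrence⇒segmentRepeatFree i s node p (u ∷ u′ ∷ ss) P@(step _ P′) o bound occ
      with length u ≤? o
    ... | no u≰o = firstNodeOccurrence⇒SpelledByNode node P o (≰⇒> u≰o) bound occ
    ... | yes u≤o with m≤n⇒∃[o]m+o≡n u≤o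
    ...   | o′ , refl = SpelledByNode-∷ u
            (noOtherRowOccurrence⇒segmentRepeatFree i s node (suc p) (u′ ∷ ss) P′ o′
              (+-cancelˡ-≤ (length u) _ _
                 (subst₂ _≤_ (+-assoc (length u) o′ (length s)) (length-++ u) bound))
              (trans (sym (sub-++ʳ u (concat (u′ ∷ ss)) o′ (length s))) occ))

lemma8 : {A : Set} {m n : ℕ} (R : MSA A m n) (S : Segmentation n) →
    (Valid R S → NoOtherRowOccurrence R S) × (NoOtherRowOccurrence R S → Valid R S)
lemma8 R S = valid⇒noOtherRowOccurrence R S , noOtherRowOccurrence⇒segmentRepeatFree R S
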